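{- Let $C:=\mathbb{Q}(T,U)$ for independent indeterminates $T,U$. Let $F(X):=\frac{X^2-U}{2X-T}\in C(X)$ (the Newton iterator of $X^2-TX+U$), $F^{(0)}(X):=X$, and $F^{(n)}$ its $n$-fold iterate. Let $a_0:=0$, $a_n:=U^{ -1}T$ for odd $n\ge1$, $a_n:=-T$ for even $n\ge2$; and $b_n:=-U^{ -1}T$ for odd $n\ge1$, $b_n:=T$ for even $n\ge0$. Then for all $n\ge0$, $$F^{(n)}(0)=[a_0;a_1,a_2,\ldots,a_{2^n-1}],\qquad F^{(n)}(T)=[b_0;b_1,b_2,\ldots,b_{2^n-1}]$$ in $C$.
   Context: $[c_0;c_1,\ldots,c_m]$ denotes the finite continued fraction $c_0+1/(c_1+1/(\cdots+1/c_m))$. -}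

module Defs where

-- The field C = ℚ(T,U), realised as the field of fractions of ℚ[U][T].
-- Polynomials are coefficient lists (lowest degree first); a polynomial is
-- zero iff all of its coefficients are zero (trailing zeros are allowed).

open import Data.Nat using (ℕ; zero; suc)
open import Data.List using (List; []; _∷_; map)
open import Data.List.Relation.Unary.All using (All; all?)
open import Data.Maybe using (Maybe; just; nothing; _>>=_)
open import Relation.Nullary using (Dec; yes; no)
open import Relation.Binary.PropositionalEquality using (_≡_)
import Data.Rational as Q
open import Data.Rational using (ℚ; 0ℚ; 1ℚ)

module PolyOver {A : Set} (0a 1a : A) (addA mulA : A → A → A) (negA : A → A) where
  Poly : Set
  Poly = List A

  _⊕_ : Poly → Poly → Poly
  [] ⊕ q = q
  (a ∷ p) ⊕ [] = a ∷ p
  (a ∷ p) ⊕ (b ∷ q) = addA a b ∷ (p ⊕ q)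

  scale : A → Poly → Poly
  scale a = map (mulA a)

  _⊗_ : Poly → Poly → Poly
  [] ⊗ q = []
  (a ∷ p) ⊗ q = scale a q ⊕ (0a ∷ (p ⊗ q))

  neg : Poly → Poly
  neg = map negA

  const : A → Poly
  const a = a ∷ []

  var : Poly
  var = 0a ∷ 1a ∷ []

module P1 = PolyOver 0ℚ 1ℚ Q._+_ Q._*_ Q.-_

IsZero₁ : P1.Poly → Set
IsZero₁ = All (λ c → c ≡ 0ℚ)

isZero₁? : (p : P1.Poly) → Dec (IsZero₁ p)
isZero₁? = all? (λ c → c Q.≟ 0ℚ)

module P2 = PolyOver [] (P1.const 1ℚ) P1._⊕_ P1._⊗_ P1.neg

Pol : Set
Pol = P2.Poly

IsZero : Pol → Set
IsZero = All IsZero₁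

isZero? : (p : Pol) → Dec (IsZero p)
isZero? = all? isZero₁?

-- All fractions built
-- below have nonzero denominator (the only place a new denominator is
-- created is `inv`, which checks that the numerator is nonzero).
record Frac : Set where
  constructor _/_
  field
    num : Pol
    den : Pol
open Frac public

constP : ℚ → Pol
constP q = P1.const q ∷ []

polT : Pol
polT = P2.var

polU : Pol
polU = P1.var ∷ []

fromPol : Pol → Frac
fromPol p = p / constP 1ℚ

0C 1C TC UC : Frac
0C = fromPol []
1C = fromPol (constP 1ℚ)
TC = fromPol polT
UC = fromPol polU

fromℚ : ℚ → Frac
fromℚ q = fromPol (constP q)

infixl 6 _+C_ _-C_
infixl 7 _*C_

_+C_ : Frac → Frac → Frac
(a / b) +C (c / d) = P2._⊕_ (P2._⊗_ a d) (P2._⊗_ c b) / P2._⊗_ b d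

-C_ : Frac → Frac
-C (a / b) = P2.neg a / b

_-C_ : Frac → Frac → Frac
x -C y = x +C (-C y)

_*C_ : Frac → Frac → Frac
(a / b) *C (c / d) = P2._⊗_ a c / P2._⊗_ b d

invC : Frac → Maybe Frac
invC (a / b) with isZero? a
... | yes _ = nothing
... | no _ = just (b / a)

_÷C_ : Frac → Frac → Maybe Frac
x ÷C y = invC y >>= λ i → just (x *C i)

_≈C_ : Frac → Frac → Set
(a / b) ≈C (c / d) = IsZero (P2._⊕_ (P2._⊗_ a d) (P2.neg (P2._⊗_ c b)))

cfrac : Frac → List Frac → Maybe Frac
cfrac c [] = just c
cfrac c (d ∷ ds) = cfrac d ds >>= λ r → invC r >>= λ i → just (c +C i)

newtonF : Frac → Maybe Frac
newtonF x = ((x *C x) -C UC) ÷C ((fromℚ (1ℚ Q.+ 1ℚ) *C x) -C TC)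

iterF : ℕ → Frac → Maybe Frac
iterF zero x = just x
iterF (suc n) x = iterF n x >>= newtonF

TdivU : Frac
TdivU = polT / polU

-- aTail k = a_{k+1}:  a_n = U⁻¹T for odd n ≥ 1, a_n = -T for even n ≥ 2
aTail : ℕ → Frac
aTail zero = TdivU
aTail (suc zero) = -C TC
aTail (suc (suc k)) = aTail k

aSeq : ℕ → Frac
aSeq zero = 0C
aSeq (suc k) = aTail k

-- bTail k = b_{k+1}:  b_n = -U⁻¹T for odd n ≥ 1, b_n = T for even n
bTail : ℕ → Frac
bTail zero = -C TdivU
bTail (suc zero) = TC
bTail (suc (suc k)) = bTail k

bSeq : ℕ → Frac
bSeq zero = TC
bSeq (suc k) = bTail k

{-# OPTIONS --safe #-}
module Submission where

-- Write s_k for the Lucas polynomials s_0 = 0, s_1 = 1, s_(k+2) = T s_(k+1) - U s_k.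
-- Unfolding the continued fractions from the back, [0; a_1, ..., a_M] = U s_M / s_(M+1)
-- and [b_0; ..., b_M] = s_(M+2) / s_(M+1).  The addition formula
-- s_(m+n+1) = s_(m+1) s_(n+1) - U s_m s_n shows that F maps U s_K / s_(K+1) to
-- U s_(2K+1) / s_(2K+2) and s_(K+2) / s_(K+1) to s_(2K+3) / s_(2K+2), so after n steps
-- K = 2^n - 1.  Every division is legitimate because each s_(k+1) takes the value 1
-- at (T, U) = (1, 0).

open import Defs
open import Level using (0ℓ)
open import Algebra.Bundles using (CommutativeRing)
open import Data.Empty using (⊥-elim)
open import Data.List using ([]; _∷_; applyUpTo)
import Data.List.Relation.Unary.All as All
open import Data.Maybe as Maybe using (Maybe; just; _>>=_)
open import Data.Product using (∃-syntax; _×_; _,_)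
open import Data.Rational as ℚ using (ℚ; 0ℚ; 1ℚ)
import Data.Rational.Properties as ℚ
open import Data.Sum using (_⊎_; inj₁; inj₂)
open import Function using (_∘_)
open import Relation.Binary.Bundles using (Setoid)
open import Relation.Binary.PropositionalEquality as ≡ using (_≡_; _≢_)
open import Relation.Nullary using (yes; no)
open import Relation.Nullary.Decidable using (dec⇒maybe)
open import Tactic.RingSolver.Core.AlmostCommutativeRing using (AlmostCommutativeRing; fromCommutativeRing)
open import Tactic.RingSolver.Core.Expression using (Κ)

module PolynomialRing (R : CommutativeRing 0ℓ 0ℓ) where
  open CommutativeRing R
  open import Algebra.Properties.Ring ring using (-0#≈0#)
  open PolyOver 0# 1# _+_ _*_ -_ public
    renaming (_⊕_ to infixl 6 _⊕_; _⊗_ to infixl 7 _⊗_)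

  infix 4 _≋_

  -- Equality of coefficient lists up to trailing zeros.
  data _≋_ : Poly → Poly → Set where
    []≋[] : [] ≋ []
    []≋0∷ : ∀ {b q} → b ≈ 0# → [] ≋ q → [] ≋ b ∷ q
    0∷≋[] : ∀ {a p} → a ≈ 0# → p ≋ [] → a ∷ p ≋ []
    ∷≋∷   : ∀ {a b p q} → a ≈ b → p ≋ q → a ∷ p ≋ b ∷ q

  ≋-refl : ∀ {p} → p ≋ p
  ≋-refl {[]} = []≋[]
  ≋-refl {a ∷ p} = ∷≋∷ refl ≋-refl

  ≋-reflexive : ∀ {p q} → p ≡ q → p ≋ q
  ≋-reflexive ≡.refl = ≋-refl

  ≋-sym : ∀ {p q} → p ≋ q → q ≋ p
  ≋-sym []≋[] = []≋[]
  ≋-sym ([]≋0∷ b≈0 e) = 0∷≋[] b≈0 (≋-sym e)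
  ≋-sym (0∷≋[] a≈0 e) = []≋0∷ a≈0 (≋-sym e)
  ≋-sym (∷≋∷ a≈b e) = ∷≋∷ (sym a≈b) (≋-sym e)

  ≋-trans : ∀ {p q r} → p ≋ q → q ≋ r → p ≋ r
  ≋-trans []≋[] f = f
  ≋-trans ([]≋0∷ _ _) (0∷≋[] _ _) = []≋[]
  ≋-trans ([]≋0∷ b≈0 e) (∷≋∷ b≈c f) = []≋0∷ (trans (sym b≈c) b≈0) (≋-trans e f)
  ≋-trans (0∷≋[] a≈0 e) []≋[] = 0∷≋[] a≈0 e
  ≋-trans (0∷≋[] a≈0 e) ([]≋0∷ c≈0 f) = ∷≋∷ (trans a≈0 (sym c≈0)) (≋-trans e f)
  ≋-trans (∷≋∷ a≈b e) (0∷≋[] b≈0 f) = 0∷≋[] (trans a≈b b≈0) (≋-trans e f)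
  ≋-trans (∷≋∷ a≈b e) (∷≋∷ b≈c f) = ∷≋∷ (trans a≈b b≈c) (≋-trans e f)

  ≋-setoid : Setoid 0ℓ 0ℓ
  ≋-setoid = record
    { Carrier = Poly ; _≈_ = _≋_
    ; isEquivalence = record { refl = ≋-refl ; sym = ≋-sym ; trans = ≋-trans } }

  open import Relation.Binary.Reasoning.Setoid ≋-setoid

  ⊕-identityʳ : ∀ p → p ⊕ [] ≡ p
  ⊕-identityʳ [] = ≡.refl
  ⊕-identityʳ (a ∷ p) = ≡.refl

  ⊕-congʳ : ∀ {p p'} q → p ≋ p' → p ⊕ q ≋ p' ⊕ q
  ⊕-congʳ q []≋[] = ≋-refl
  ⊕-congʳ [] e@([]≋0∷ _ _) = e
  ⊕-congʳ (c ∷ q) ([]≋0∷ b≈0 e) = ∷≋∷ (trans (sym (+-identityˡ c)) (+-congʳ (sym b≈0))) (⊕-congʳ q e)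
  ⊕-congʳ [] e@(0∷≋[] _ _) = e
  ⊕-congʳ (c ∷ q) (0∷≋[] a≈0 e) = ∷≋∷ (trans (+-congʳ a≈0) (+-identityˡ c)) (⊕-congʳ q e)
  ⊕-congʳ [] e@(∷≋∷ _ _) = e
  ⊕-congʳ (c ∷ q) (∷≋∷ a≈b e) = ∷≋∷ (+-congʳ a≈b) (⊕-congʳ q e)

  ⊕-comm : ∀ p q → p ⊕ q ≋ q ⊕ p
  ⊕-comm [] q = ≋-reflexive (≡.sym (⊕-identityʳ q))
  ⊕-comm (a ∷ p) [] = ≋-refl
  ⊕-comm (a ∷ p) (b ∷ q) = ∷≋∷ (+-comm a b) (⊕-comm p q)

  ⊕-congˡ : ∀ p {q q'} → q ≋ q' → p ⊕ q ≋ p ⊕ q'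
  ⊕-congˡ p {q} {q'} e = begin
    p ⊕ q  ≈⟨ ⊕-comm p q ⟩
    q ⊕ p  ≈⟨ ⊕-congʳ p e ⟩
    q' ⊕ p ≈⟨ ⊕-comm q' p ⟩
    p ⊕ q' ∎

  ⊕-cong : ∀ {p p' q q'} → p ≋ p' → q ≋ q' → p ⊕ q ≋ p' ⊕ q'
  ⊕-cong {p' = p'} {q = q} e f = ≋-trans (⊕-congʳ q e) (⊕-congˡ p' f)

  ⊕-assoc : ∀ p q r → (p ⊕ q) ⊕ r ≋ p ⊕ (q ⊕ r)
  ⊕-assoc [] q r = ≋-refl
  ⊕-assoc (a ∷ p) [] r = ≋-refl
  ⊕-assoc (a ∷ p) (b ∷ q) [] = ≋-refl
  ⊕-assoc (a ∷ p) (b ∷ q) (c ∷ r) = ∷≋∷ (+-assoc a b c) (⊕-assoc p q r)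

  ⊕-interchange : ∀ p q r t → (p ⊕ q) ⊕ (r ⊕ t) ≋ (p ⊕ r) ⊕ (q ⊕ t)
  ⊕-interchange p q r t = begin
    (p ⊕ q) ⊕ (r ⊕ t) ≈⟨ ⊕-assoc p q (r ⊕ t) ⟩
    p ⊕ (q ⊕ (r ⊕ t)) ≈⟨ ⊕-congˡ p (⊕-assoc q r t) ⟨
    p ⊕ ((q ⊕ r) ⊕ t) ≈⟨ ⊕-congˡ p (⊕-congʳ t (⊕-comm q r)) ⟩
    p ⊕ ((r ⊕ q) ⊕ t) ≈⟨ ⊕-congˡ p (⊕-assoc r q t) ⟩
    p ⊕ (r ⊕ (q ⊕ t)) ≈⟨ ⊕-assoc p r (q ⊕ t) ⟨
    (p ⊕ r) ⊕ (q ⊕ t) ∎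

  neg-cong : ∀ {p q} → p ≋ q → neg p ≋ neg q
  neg-cong []≋[] = []≋[]
  neg-cong ([]≋0∷ b≈0 e) = []≋0∷ (trans (-‿cong b≈0) -0#≈0#) (neg-cong e)
  neg-cong (0∷≋[] a≈0 e) = 0∷≋[] (trans (-‿cong a≈0) -0#≈0#) (neg-cong e)
  neg-cong (∷≋∷ a≈b e) = ∷≋∷ (-‿cong a≈b) (neg-cong e)

  ⊕-inverseʳ : ∀ p → p ⊕ neg p ≋ []
  ⊕-inverseʳ [] = []≋[]
  ⊕-inverseʳ (a ∷ p) = 0∷≋[] (-‿inverseʳ a) (⊕-inverseʳ p)

  ⊕-inverseˡ : ∀ p → neg p ⊕ p ≋ []
  ⊕-inverseˡ p = ≋-trans (⊕-comm (neg p) p) (⊕-inverseʳ p)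

  ⊕-zero : ∀ {p q} → p ≋ [] → q ≋ [] → p ⊕ q ≋ []
  ⊕-zero {q = q} e f = ≋-trans (⊕-congʳ q e) f

  scale-cong : ∀ {a b p q} → a ≈ b → p ≋ q → scale a p ≋ scale b q
  scale-cong a≈b []≋[] = []≋[]
  scale-cong a≈b ([]≋0∷ c≈0 e) = []≋0∷ (trans (*-congˡ c≈0) (zeroʳ _)) (scale-cong a≈b e)
  scale-cong a≈b (0∷≋[] c≈0 e) = 0∷≋[] (trans (*-congˡ c≈0) (zeroʳ _)) (scale-cong a≈b e)
  scale-cong a≈b (∷≋∷ c≈d e) = ∷≋∷ (*-cong a≈b c≈d) (scale-cong a≈b e)

  scale-zeroˡ : ∀ {a} p → a ≈ 0# → scale a p ≋ []
  scale-zeroˡ [] a≈0 = []≋[]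
  scale-zeroˡ (b ∷ p) a≈0 = 0∷≋[] (trans (*-congʳ a≈0) (zeroˡ b)) (scale-zeroˡ p a≈0)

  scale-distribˡ : ∀ a p q → scale a (p ⊕ q) ≋ scale a p ⊕ scale a q
  scale-distribˡ a [] q = ≋-refl
  scale-distribˡ a (b ∷ p) [] = ≋-refl
  scale-distribˡ a (b ∷ p) (c ∷ q) = ∷≋∷ (distribˡ a b c) (scale-distribˡ a p q)

  scale-distribʳ : ∀ a b p → scale (a + b) p ≋ scale a p ⊕ scale b p
  scale-distribʳ a b [] = []≋[]
  scale-distribʳ a b (c ∷ p) = ∷≋∷ (distribʳ c a b) (scale-distribʳ a b p)

  scale-assoc : ∀ a b p → scale a (scale b p) ≋ scale (a * b) p
  scale-assoc a b [] = []≋[]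
  scale-assoc a b (c ∷ p) = ∷≋∷ (sym (*-assoc a b c)) (scale-assoc a b p)

  scale-identity : ∀ p → scale 1# p ≋ p
  scale-identity [] = []≋[]
  scale-identity (c ∷ p) = ∷≋∷ (*-identityˡ c) (scale-identity p)

  ⊗-zeroʳ : ∀ p → p ⊗ [] ≋ []
  ⊗-zeroʳ [] = []≋[]
  ⊗-zeroʳ (a ∷ p) = 0∷≋[] refl (⊗-zeroʳ p)

  ⊗-zeroˡ : ∀ {p} q → p ≋ [] → p ⊗ q ≋ []
  ⊗-zeroˡ q []≋[] = []≋[]
  ⊗-zeroˡ q (0∷≋[] a≈0 e) = ⊕-zero (scale-zeroˡ q a≈0) (0∷≋[] refl (⊗-zeroˡ q e))

  ⊗-congʳ : ∀ {p p'} q → p ≋ p' → p ⊗ q ≋ p' ⊗ q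
  ⊗-congʳ q []≋[] = []≋[]
  ⊗-congʳ q ([]≋0∷ b≈0 e) = ≋-sym (⊗-zeroˡ q (0∷≋[] b≈0 (≋-sym e)))
  ⊗-congʳ q e@(0∷≋[] _ _) = ⊗-zeroˡ q e
  ⊗-congʳ q (∷≋∷ a≈b e) = ⊕-cong (scale-cong a≈b ≋-refl) (∷≋∷ refl (⊗-congʳ q e))

  ⊗-distribʳ : ∀ p p' q → (p ⊕ p') ⊗ q ≋ p ⊗ q ⊕ p' ⊗ q
  ⊗-distribʳ [] p' q = ≋-refl
  ⊗-distribʳ (a ∷ p) [] q = ≋-reflexive (≡.sym (⊕-identityʳ _))
  ⊗-distribʳ (a ∷ p) (b ∷ p') q = begin
    scale (a + b) q ⊕ (0# ∷ (p ⊕ p') ⊗ q)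
      ≈⟨ ⊕-cong (scale-distribʳ a b q) (∷≋∷ (sym (+-identityˡ 0#)) (⊗-distribʳ p p' q)) ⟩
    (scale a q ⊕ scale b q) ⊕ ((0# ∷ p ⊗ q) ⊕ (0# ∷ p' ⊗ q))
      ≈⟨ ⊕-interchange (scale a q) (scale b q) (0# ∷ p ⊗ q) (0# ∷ p' ⊗ q) ⟩
    (scale a q ⊕ (0# ∷ p ⊗ q)) ⊕ (scale b q ⊕ (0# ∷ p' ⊗ q)) ∎

  ⊗-consʳ : ∀ p b q → p ⊗ (b ∷ q) ≋ scale b p ⊕ (0# ∷ p ⊗ q)
  ⊗-consʳ [] b q = []≋0∷ refl []≋[]
  ⊗-consʳ (a ∷ p) b q = ∷≋∷ (trans (+-identityʳ _) (trans (*-comm a b) (sym (+-identityʳ _)))) (begin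
    scale a q ⊕ p ⊗ (b ∷ q)                 ≈⟨ ⊕-congˡ (scale a q) (⊗-consʳ p b q) ⟩
    scale a q ⊕ (scale b p ⊕ (0# ∷ p ⊗ q))  ≈⟨ ⊕-assoc (scale a q) (scale b p) _ ⟨
    (scale a q ⊕ scale b p) ⊕ (0# ∷ p ⊗ q)  ≈⟨ ⊕-congʳ _ (⊕-comm (scale a q) (scale b p)) ⟩
    (scale b p ⊕ scale a q) ⊕ (0# ∷ p ⊗ q)  ≈⟨ ⊕-assoc (scale b p) (scale a q) _ ⟩
    scale b p ⊕ (scale a q ⊕ (0# ∷ p ⊗ q))  ∎)

  ⊗-comm : ∀ p q → p ⊗ q ≋ q ⊗ p
  ⊗-comm [] q = ≋-sym (⊗-zeroʳ q)
  ⊗-comm (a ∷ p) q = ≋-trans (⊕-congˡ (scale a q) (∷≋∷ refl (⊗-comm p q))) (≋-sym (⊗-consʳ q a p))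

  ⊗-congˡ : ∀ p {q q'} → q ≋ q' → p ⊗ q ≋ p ⊗ q'
  ⊗-congˡ p {q} {q'} e = begin
    p ⊗ q  ≈⟨ ⊗-comm p q ⟩
    q ⊗ p  ≈⟨ ⊗-congʳ p e ⟩
    q' ⊗ p ≈⟨ ⊗-comm q' p ⟩
    p ⊗ q' ∎

  ⊗-cong : ∀ {p p' q q'} → p ≋ p' → q ≋ q' → p ⊗ q ≋ p' ⊗ q'
  ⊗-cong {p' = p'} {q = q} e f = ≋-trans (⊗-congʳ q e) (⊗-congˡ p' f)

  scale-⊗ : ∀ a q r → scale a q ⊗ r ≋ scale a (q ⊗ r)
  scale-⊗ a [] r = []≋[]
  scale-⊗ a (b ∷ q) r = begin
    scale (a * b) r ⊕ (0# ∷ scale a q ⊗ r)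
      ≈⟨ ⊕-cong (≋-sym (scale-assoc a b r)) (∷≋∷ (sym (zeroʳ a)) (scale-⊗ a q r)) ⟩
    scale a (scale b r) ⊕ scale a (0# ∷ q ⊗ r)
      ≈⟨ scale-distribˡ a (scale b r) (0# ∷ q ⊗ r) ⟨
    scale a (scale b r ⊕ (0# ∷ q ⊗ r))
      ∎

  ⊗-assoc : ∀ p q r → (p ⊗ q) ⊗ r ≋ p ⊗ (q ⊗ r)
  ⊗-assoc [] q r = []≋[]
  ⊗-assoc (a ∷ p) q r = begin
    (scale a q ⊕ (0# ∷ p ⊗ q)) ⊗ r           ≈⟨ ⊗-distribʳ (scale a q) (0# ∷ p ⊗ q) r ⟩
    scale a q ⊗ r ⊕ (0# ∷ p ⊗ q) ⊗ r         ≈⟨ ⊕-cong (scale-⊗ a q r) (⊕-congʳ _ (scale-zeroˡ r refl)) ⟩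
    scale a (q ⊗ r) ⊕ (0# ∷ (p ⊗ q) ⊗ r)     ≈⟨ ⊕-congˡ _ (∷≋∷ refl (⊗-assoc p q r)) ⟩
    scale a (q ⊗ r) ⊕ (0# ∷ p ⊗ (q ⊗ r))     ∎

  ⊗-identityˡ : ∀ p → const 1# ⊗ p ≋ p
  ⊗-identityˡ p = ≋-trans (⊕-congʳ (0# ∷ []) (scale-identity p)) (⊕-identityʳ′ p)
    where
    ⊕-identityʳ′ : ∀ p → p ⊕ (0# ∷ []) ≋ p
    ⊕-identityʳ′ [] = 0∷≋[] refl []≋[]
    ⊕-identityʳ′ (a ∷ p) = ∷≋∷ (+-identityʳ a) (≋-reflexive (⊕-identityʳ p))

  ⊗-distribˡ : ∀ p q r → p ⊗ (q ⊕ r) ≋ p ⊗ q ⊕ p ⊗ r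
  ⊗-distribˡ p q r = begin
    p ⊗ (q ⊕ r)       ≈⟨ ⊗-comm p (q ⊕ r) ⟩
    (q ⊕ r) ⊗ p       ≈⟨ ⊗-distribʳ q r p ⟩
    q ⊗ p ⊕ r ⊗ p     ≈⟨ ⊕-cong (⊗-comm q p) (⊗-comm r p) ⟩
    p ⊗ q ⊕ p ⊗ r     ∎

  commutativeRing : CommutativeRing 0ℓ 0ℓ
  commutativeRing = record
    { Carrier = Poly ; _≈_ = _≋_ ; _+_ = _⊕_ ; _*_ = _⊗_ ; -_ = neg ; 0# = [] ; 1# = const 1#
    ; isCommutativeRing = record
      { isRing = record
        { +-isAbelianGroup = record
          { isGroup = record
            { isMonoid = record
              { isSemigroup = record
                { isMagma = record { isEquivalence = Setoid.isEquivalence ≋-setoid ; ∙-cong = ⊕-cong }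
                ; assoc = ⊕-assoc }
              ; identity = (λ p → ≋-refl) , (λ p → ≋-reflexive (⊕-identityʳ p)) }
            ; inverse = ⊕-inverseˡ , ⊕-inverseʳ
            ; ⁻¹-cong = neg-cong }
          ; comm = ⊕-comm }
        ; *-cong = ⊗-cong
        ; *-assoc = ⊗-assoc
        ; *-identity = ⊗-identityˡ , (λ p → ≋-trans (⊗-comm p (const 1#)) (⊗-identityˡ p))
        ; distrib = ⊗-distribˡ , (λ p q r → ⊗-distribʳ q r p) }
      ; *-comm = ⊗-comm } }

module PolynomialEvaluation (R : CommutativeRing 0ℓ 0ℓ) where
  open CommutativeRing R
  open import Algebra.Properties.Ring ring using (-0#≈0#; -‿distribʳ-*; -‿+-comm)
  open PolynomialRing R using (Poly; _≋_; []≋[]; []≋0∷; 0∷≋[]; ∷≋∷; _⊕_; _⊗_; scale; neg)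
  open import Relation.Binary.Reasoning.Setoid setoid
  open import Algebra.Properties.CommutativeSemigroup +-commutativeSemigroup
    using () renaming (interchange to +-interchange)
  open import Algebra.Properties.CommutativeSemigroup *-commutativeSemigroup
    using () renaming (x∙yz≈y∙xz to x*yz≈y*xz)

  eval : Carrier → Poly → Carrier
  eval x [] = 0#
  eval x (a ∷ p) = a + x * eval x p

  module _ (x : Carrier) where

    private
      horner-zero : ∀ {a e} → a ≈ 0# → e ≈ 0# → a + x * e ≈ 0#
      horner-zero a≈0 e≈0 = trans (+-cong a≈0 (trans (*-congˡ e≈0) (zeroʳ x))) (+-identityʳ 0#)

    eval-cong : ∀ {p q} → p ≋ q → eval x p ≈ eval x q
    eval-cong []≋[] = refl
    eval-cong ([]≋0∷ b≈0 e) = sym (horner-zero b≈0 (sym (eval-cong e)))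
    eval-cong (0∷≋[] a≈0 e) = horner-zero a≈0 (eval-cong e)
    eval-cong (∷≋∷ a≈b e) = +-cong a≈b (*-congˡ (eval-cong e))

    eval-⊕ : ∀ p q → eval x (p ⊕ q) ≈ eval x p + eval x q
    eval-⊕ [] q = sym (+-identityˡ (eval x q))
    eval-⊕ (a ∷ p) [] = sym (+-identityʳ (eval x (a ∷ p)))
    eval-⊕ (a ∷ p) (b ∷ q) = begin
      (a + b) + x * eval x (p ⊕ q)             ≈⟨ +-congˡ (*-congˡ (eval-⊕ p q)) ⟩
      (a + b) + x * (eval x p + eval x q)      ≈⟨ +-congˡ (distribˡ x (eval x p) (eval x q)) ⟩
      (a + b) + (x * eval x p + x * eval x q)  ≈⟨ +-interchange a b (x * eval x p) (x * eval x q) ⟩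
      (a + x * eval x p) + (b + x * eval x q)  ∎

    eval-scale : ∀ a p → eval x (scale a p) ≈ a * eval x p
    eval-scale a [] = sym (zeroʳ a)
    eval-scale a (b ∷ p) = begin
      a * b + x * eval x (scale a p)  ≈⟨ +-congˡ (*-congˡ (eval-scale a p)) ⟩
      a * b + x * (a * eval x p)      ≈⟨ +-congˡ (x*yz≈y*xz x a (eval x p)) ⟩
      a * b + a * (x * eval x p)      ≈⟨ distribˡ a b (x * eval x p) ⟨
      a * (b + x * eval x p)          ∎

    eval-⊗ : ∀ p q → eval x (p ⊗ q) ≈ eval x p * eval x q
    eval-⊗ [] q = sym (zeroˡ (eval x q))
    eval-⊗ (a ∷ p) q = begin
      eval x (scale a q ⊕ (0# ∷ p ⊗ q))                 ≈⟨ eval-⊕ (scale a q) (0# ∷ p ⊗ q) ⟩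
      eval x (scale a q) + (0# + x * eval x (p ⊗ q))
        ≈⟨ +-cong (eval-scale a q) (trans (+-identityˡ _) (*-congˡ (eval-⊗ p q))) ⟩
      a * eval x q + x * (eval x p * eval x q)           ≈⟨ +-congˡ (*-assoc x (eval x p) (eval x q)) ⟨
      a * eval x q + (x * eval x p) * eval x q           ≈⟨ distribʳ (eval x q) a (x * eval x p) ⟨
      (a + x * eval x p) * eval x q                      ∎

    eval-neg : ∀ p → eval x (neg p) ≈ - eval x p
    eval-neg [] = sym -0#≈0#
    eval-neg (a ∷ p) = begin
      - a + x * eval x (neg p)  ≈⟨ +-congˡ (*-congˡ (eval-neg p)) ⟩
      - a + x * - eval x p      ≈⟨ +-congˡ (-‿distribʳ-* x (eval x p)) ⟨
      - a + - (x * eval x p)    ≈⟨ -‿+-comm a (x * eval x p) ⟩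
      - (a + x * eval x p)      ∎

open import Data.Nat using (ℕ; zero; suc; _+_; _*_; _^_; _∸_; NonZero)
open import Data.Nat.Properties using (+-suc; +-identityʳ; m^n≢0)

module ℚ[U] = PolynomialRing ℚ.+-*-commutativeRing
module ℚ[U][T] = PolynomialRing ℚ[U].commutativeRing

open ℚ[U][T] using (_≋_; _⊕_; _⊗_; neg; ≋-refl; ≋-sym; ≋-trans; ≋-setoid;
  ⊕-cong; ⊗-cong; ⊗-congˡ; ⊗-assoc; ⊗-identityˡ; neg-cong)

IsZero₁⇒≋[] : ∀ {p} → IsZero₁ p → p ℚ[U].≋ []
IsZero₁⇒≋[] All.[] = ℚ[U].[]≋[]
IsZero₁⇒≋[] (a≡0 All.∷ z) = ℚ[U].0∷≋[] a≡0 (IsZero₁⇒≋[] z)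

IsZero⇒≋[] : ∀ {p} → IsZero p → p ≋ []
IsZero⇒≋[] All.[] = ℚ[U][T].[]≋[]
IsZero⇒≋[] (a≡0 All.∷ z) = ℚ[U][T].0∷≋[] (IsZero₁⇒≋[] a≡0) (IsZero⇒≋[] z)

≋[]⇒IsZero₁ : ∀ {p} → p ℚ[U].≋ [] → IsZero₁ p
≋[]⇒IsZero₁ ℚ[U].[]≋[] = All.[]
≋[]⇒IsZero₁ (ℚ[U].0∷≋[] a≡0 z) = a≡0 All.∷ ≋[]⇒IsZero₁ z

≋[]⇒IsZero : ∀ {p} → p ≋ [] → IsZero p
≋[]⇒IsZero ℚ[U][T].[]≋[] = All.[]
≋[]⇒IsZero (ℚ[U][T].0∷≋[] a≈0 z) = ≋[]⇒IsZero₁ a≈0 All.∷ ≋[]⇒IsZero z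

ℚ[T,U] : AlmostCommutativeRing 0ℓ 0ℓ
ℚ[T,U] = fromCommutativeRing ℚ[U][T].commutativeRing
  (λ p → Maybe.map (≋-sym ∘ IsZero⇒≋[]) (dec⇒maybe (isZero? p)))

open import Tactic.RingSolver.NonReflective ℚ[T,U] using (solve)
  renaming (_⊜_ to infix 4 _⊜_; _⊕_ to infixl 6 _:+_; _⊗_ to infixl 7 _:*_; ⊝_ to infix 8 :-_)

1P : Pol
1P = constP 1ℚ

lucas : ℕ → Pol
lucas zero = []
lucas (suc zero) = 1P
lucas (suc (suc k)) = polT ⊗ lucas (suc k) ⊕ neg (polU ⊗ lucas k)

lucas-+ : ∀ m n → lucas (suc (m + n)) ≋ lucas (suc m) ⊗ lucas (suc n) ⊕ neg (polU ⊗ lucas m ⊗ lucas n)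
lucas-+ zero n = solve 3 (λ u a b → a ⊜ Κ 1P :* a :+ :- (u :* Κ [] :* b)) ≋-refl polU (lucas (suc n)) (lucas n)
lucas-+ (suc m) n = begin
  lucas (suc (suc (m + n)))  ≡⟨ ≡.cong (lucas ∘ suc) (+-suc m n) ⟨
  lucas (suc (m + suc n))    ≈⟨ lucas-+ m (suc n) ⟩
  lucas (suc m) ⊗ lucas (suc (suc n)) ⊕ neg (polU ⊗ lucas m ⊗ lucas (suc n))
    ≈⟨ solve 6 (λ t u a b c d → a :* (t :* c :+ :- (u :* d)) :+ :- (u :* b :* c)
                              ⊜ (t :* a :+ :- (u :* b)) :* c :+ :- (u :* a :* d))
         ≋-refl polT polU (lucas (suc m)) (lucas m) (lucas (suc n)) (lucas n) ⟩
  lucas (suc (suc m)) ⊗ lucas (suc n) ⊕ neg (polU ⊗ lucas (suc m) ⊗ lucas n)  ∎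
  where open import Relation.Binary.Reasoning.Setoid ≋-setoid

module EvalU = PolynomialEvaluation ℚ.+-*-commutativeRing
module EvalT = PolynomialEvaluation ℚ[U].commutativeRing

T↦1 : Pol → ℚ[U].Poly
T↦1 = EvalT.eval (ℚ[U].const 1ℚ)

ev : Pol → ℚ
ev p = EvalU.eval 0ℚ (T↦1 p)

ev-cong : ∀ {p q} → p ≋ q → ev p ≡ ev q
ev-cong e = EvalU.eval-cong 0ℚ (EvalT.eval-cong _ e)

ev-⊕ : ∀ p q → ev (p ⊕ q) ≡ ev p ℚ.+ ev q
ev-⊕ p q = ≡.trans (EvalU.eval-cong 0ℚ (EvalT.eval-⊕ _ p q)) (EvalU.eval-⊕ 0ℚ (T↦1 p) (T↦1 q))

ev-⊗ : ∀ p q → ev (p ⊗ q) ≡ ev p ℚ.* ev q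
ev-⊗ p q = ≡.trans (EvalU.eval-cong 0ℚ (EvalT.eval-⊗ _ p q)) (EvalU.eval-⊗ 0ℚ (T↦1 p) (T↦1 q))

ev-neg : ∀ p → ev (neg p) ≡ ℚ.- ev p
ev-neg p = ≡.trans (EvalU.eval-cong 0ℚ (EvalT.eval-neg _ p)) (EvalU.eval-neg 0ℚ (T↦1 p))

ev-lucas : ∀ k → ev (lucas (suc k)) ≡ 1ℚ
ev-lucas zero = ≡.refl
ev-lucas (suc k) = begin
  ev (polT ⊗ lucas (suc k) ⊕ neg (polU ⊗ lucas k))
    ≡⟨ ev-⊕ (polT ⊗ lucas (suc k)) (neg (polU ⊗ lucas k)) ⟩
  ev (polT ⊗ lucas (suc k)) ℚ.+ ev (neg (polU ⊗ lucas k))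
    ≡⟨ ≡.cong₂ ℚ._+_ (ev-⊗ polT (lucas (suc k)))
                     (≡.trans (ev-neg (polU ⊗ lucas k)) (≡.cong ℚ.-_ (ev-⊗ polU (lucas k)))) ⟩
  1ℚ ℚ.* ev (lucas (suc k)) ℚ.+ ℚ.- (0ℚ ℚ.* ev (lucas k))
    ≡⟨ ≡.cong₂ (λ a b → 1ℚ ℚ.* a ℚ.+ ℚ.- b) (ev-lucas k) (ℚ.*-zeroˡ (ev (lucas k))) ⟩
  1ℚ ∎
  where open ≡.≡-Reasoning

IsSign : ℚ → Set
IsSign q = q ≡ 1ℚ ⊎ q ≡ ℚ.- 1ℚ

sign-* : ∀ {a b} → IsSign a → IsSign b → IsSign (a ℚ.* b)
sign-* (inj₁ ≡.refl) (inj₁ ≡.refl) = inj₁ ≡.refl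
sign-* (inj₁ ≡.refl) (inj₂ ≡.refl) = inj₂ ≡.refl
sign-* (inj₂ ≡.refl) (inj₁ ≡.refl) = inj₂ ≡.refl
sign-* (inj₂ ≡.refl) (inj₂ ≡.refl) = inj₁ ≡.refl

sign-neg : ∀ {a} → IsSign a → IsSign (ℚ.- a)
sign-neg (inj₁ ≡.refl) = inj₂ ≡.refl
sign-neg (inj₂ ≡.refl) = inj₁ ≡.refl

sign⇒≢0 : ∀ {a} → IsSign a → a ≢ 0ℚ
sign⇒≢0 (inj₁ ≡.refl) ()
sign⇒≢0 (inj₂ ≡.refl) ()

sign-ev-⊗ : ∀ p q → IsSign (ev p) → IsSign (ev q) → IsSign (ev (p ⊗ q))
sign-ev-⊗ p q sp sq = ≡.subst IsSign (≡.sym (ev-⊗ p q)) (sign-* sp sq)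

sign-ev-neg : ∀ p → IsSign (ev p) → IsSign (ev (neg p))
sign-ev-neg p sp = ≡.subst IsSign (≡.sym (ev-neg p)) (sign-neg sp)

sign-ev-lucas : ∀ k → IsSign (ev (lucas (suc k)))
sign-ev-lucas k = inj₁ (ev-lucas k)

infix 4 _≐_∕_ _⇓_∕_

-- x equals A / B up to a common factor; asking the factor to be ±1 at (T, U) = (1, 0) is what
-- certifies that the numerators inverted by invC are nonzero.
record _≐_∕_ (x : Frac) (A B : Pol) : Set where
  constructor represents
  field
    factor : Pol
    factor-sign : IsSign (ev factor)
    num≋ : num x ≋ factor ⊗ A
    den≋ : den x ≋ factor ⊗ B

_⇓_∕_ : Maybe Frac → Pol → Pol → Set
m ⇓ A ∕ B = ∃[ x ] m ≡ just x × x ≐ A ∕ B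

≐-self : ∀ x → x ≐ num x ∕ den x
≐-self x = represents 1P (inj₁ ≡.refl) (≋-sym (⊗-identityˡ (num x))) (≋-sym (⊗-identityˡ (den x)))

≐-rescale : ∀ {x A B A' B'} k → IsSign (ev k) → A ≋ k ⊗ A' → B ≋ k ⊗ B' → x ≐ A ∕ B → x ≐ A' ∕ B'
≐-rescale {A' = A'} {B'} k sk A≋ B≋ (represents c sc num≋ den≋) =
  represents (c ⊗ k) (sign-ev-⊗ c k sc sk)
    (≋-trans num≋ (≋-trans (⊗-congˡ c A≋) (≋-sym (⊗-assoc c k A'))))
    (≋-trans den≋ (≋-trans (⊗-congˡ c B≋) (≋-sym (⊗-assoc c k B'))))

≐-resp : ∀ {x A B A' B'} → A ≋ A' → B ≋ B' → x ≐ A ∕ B → x ≐ A' ∕ B'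
≐-resp A≋ B≋ (represents c sc num≋ den≋) =
  represents c sc (≋-trans num≋ (⊗-congˡ c A≋)) (≋-trans den≋ (⊗-congˡ c B≋))

+C-≐ : ∀ {x y A B C D} → x ≐ A ∕ B → y ≐ C ∕ D → x +C y ≐ A ⊗ D ⊕ C ⊗ B ∕ B ⊗ D
+C-≐ {A = A} {B} {C} {D} (represents c sc xn xd) (represents d sd yn yd) =
  represents (c ⊗ d) (sign-ev-⊗ c d sc sd)
    (≋-trans (⊕-cong (⊗-cong xn yd) (⊗-cong yn xd))
      (solve 6 (λ c d a b x y → c :* a :* (d :* y) :+ d :* x :* (c :* b) ⊜ c :* d :* (a :* y :+ x :* b))
         ≋-refl c d A B C D))
    (≋-trans (⊗-cong xd yd) (solve 4 (λ c d b y → c :* b :* (d :* y) ⊜ c :* d :* (b :* y)) ≋-refl c d B D))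

*C-≐ : ∀ {x y A B C D} → x ≐ A ∕ B → y ≐ C ∕ D → x *C y ≐ A ⊗ C ∕ B ⊗ D
*C-≐ {A = A} {B} {C} {D} (represents c sc xn xd) (represents d sd yn yd) =
  represents (c ⊗ d) (sign-ev-⊗ c d sc sd)
    (≋-trans (⊗-cong xn yn) (solve 4 (λ c d a x → c :* a :* (d :* x) ⊜ c :* d :* (a :* x)) ≋-refl c d A C))
    (≋-trans (⊗-cong xd yd) (solve 4 (λ c d b y → c :* b :* (d :* y) ⊜ c :* d :* (b :* y)) ≋-refl c d B D))

-C-≐ : ∀ {x A B} → x ≐ A ∕ B → -C x ≐ neg A ∕ B
-C-≐ {A = A} (represents c sc xn xd) =
  represents c sc (≋-trans (neg-cong xn) (solve 2 (λ c a → :- (c :* a) ⊜ c :* (:- a)) ≋-refl c A)) xd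

invC-⇓ : ∀ {x A B} → x ≐ A ∕ B → IsSign (ev A) → invC x ⇓ B ∕ A
invC-⇓ {x} {A} x≐@(represents c sc xn xd) sA with isZero? (num x)
... | yes num≋0 =
  ⊥-elim (sign⇒≢0 (sign-ev-⊗ c A sc sA) (≡.trans (ev-cong (≋-sym xn)) (ev-cong (IsZero⇒≋[] num≋0))))
... | no _ = den x / num x , ≡.refl , represents c sc xd xn

just-⇓ : ∀ {x A B} → x ≐ A ∕ B → just x ⇓ A ∕ B
just-⇓ x≐ = _ , ≡.refl , x≐

>>=-⇓ : ∀ {m A B C D} {f : Frac → Maybe Frac} →
  m ⇓ A ∕ B → (∀ {x} → x ≐ A ∕ B → f x ⇓ C ∕ D) → (m >>= f) ⇓ C ∕ D
>>=-⇓ (x , ≡.refl , x≐) f⇓ = f⇓ x≐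

⇓-map : ∀ {m A B C D} → (∀ {x} → x ≐ A ∕ B → x ≐ C ∕ D) → m ⇓ A ∕ B → m ⇓ C ∕ D
⇓-map g (x , m≡ , x≐) = x , m≡ , g x≐

≐-≈C : ∀ {x y A B} → x ≐ A ∕ B → y ≐ A ∕ B → x ≈C y
≐-≈C {A = A} {B} (represents c _ xn xd) (represents d _ yn yd) =
  ≋[]⇒IsZero (≋-trans (⊕-cong (⊗-cong xn yd) (neg-cong (⊗-cong yn xd)))
    (solve 4 (λ c d a b → c :* a :* (d :* b) :+ :- (d :* a :* (c :* b)) ⊜ Κ []) ≋-refl c d A B))

⇓-agree : ∀ {m m' A B} → m ⇓ A ∕ B → m' ⇓ A ∕ B →
  ∃[ x ] ∃[ y ] (m ≡ just x) × (m' ≡ just y) × (x ≈C y)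
⇓-agree (x , m≡ , x≐) (y , m'≡ , y≐) = x , y , m≡ , m'≡ , ≐-≈C x≐ y≐

cfrac-∷-⇓ : ∀ {c d ds P Q A B} → c ≐ P ∕ Q → cfrac d ds ⇓ A ∕ B → IsSign (ev A) →
  cfrac c (d ∷ ds) ⇓ P ⊗ A ⊕ B ⊗ Q ∕ Q ⊗ A
cfrac-∷-⇓ c≐ tail⇓ sA = >>=-⇓ tail⇓ λ r≐ → >>=-⇓ (invC-⇓ r≐ sA) λ i≐ → just-⇓ (+C-≐ c≐ i≐)

newtonF-⇓ : ∀ {x A B} → x ≐ A ∕ B → IsSign (ev B) → IsSign (ev (A ⊕ A ⊕ neg (polT ⊗ B))) →
  newtonF x ⇓ A ⊗ A ⊕ neg (polU ⊗ B ⊗ B) ∕ B ⊗ (A ⊕ A ⊕ neg (polT ⊗ B))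
newtonF-⇓ {x} {A} {B} x≐ sB sD =
  >>=-⇓ (invC-⇓ denominator≐ sD) λ i≐ →
    just-⇓ (≐-rescale B sB
      (solve 3 (λ u a b → (a :* a :+ :- (u :* b :* b)) :* b ⊜ b :* (a :* a :+ :- (u :* b :* b))) ≋-refl polU A B)
      (⊗-assoc B B _)
      (*C-≐ numerator≐ i≐))
  where
  numerator≐ : (x *C x) -C UC ≐ A ⊗ A ⊕ neg (polU ⊗ B ⊗ B) ∕ B ⊗ B
  numerator≐ = ≐-resp
    (solve 3 (λ u a b → a :* a :* Κ 1P :+ (:- u) :* (b :* b) ⊜ a :* a :+ :- (u :* b :* b)) ≋-refl polU A B)
    (solve 1 (λ b → b :* b :* Κ 1P ⊜ b :* b) ≋-refl B)
    (+C-≐ (*C-≐ x≐ x≐) (-C-≐ (≐-self UC)))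
  denominator≐ : (fromℚ (1ℚ ℚ.+ 1ℚ) *C x) -C TC ≐ A ⊕ A ⊕ neg (polT ⊗ B) ∕ B
  denominator≐ = ≐-resp
    (solve 3 (λ t a b → (Κ 1P :+ Κ 1P) :* a :* Κ 1P :+ (:- t) :* (Κ 1P :* b) ⊜ a :+ a :+ :- (t :* b)) ≋-refl polT A B)
    (solve 1 (λ b → Κ 1P :* b :* Κ 1P ⊜ b) ≋-refl B)
    (+C-≐ (*C-≐ (≐-self (fromℚ (1ℚ ℚ.+ 1ℚ))) x≐) (-C-≐ (≐-self TC)))

0C-≐ : 0C ≐ polU ⊗ lucas 0 ∕ lucas 1
0C-≐ = ≐-resp (solve 1 (λ u → Κ [] ⊜ u :* Κ []) ≋-refl polU) ≋-refl (≐-self 0C)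

TC-≐ : TC ≐ lucas 2 ∕ lucas 1
TC-≐ = ≐-resp (solve 2 (λ t u → t ⊜ t :* Κ 1P :+ :- (u :* Κ [])) ≋-refl polT polU) ≋-refl (≐-self TC)

-- As b_0 = b_2, cfrac-bTail₁ also describes [b_0; b_1, ..., b_m].
cfrac-aTail₀ : ∀ m → cfrac (aTail 0) (applyUpTo (λ i → aTail (suc i)) m)
                       ⇓ lucas (suc (suc m)) ∕ polU ⊗ lucas (suc m)
cfrac-aTail₁ : ∀ m → cfrac (aTail 1) (applyUpTo aTail m) ⇓ neg (lucas (suc (suc m))) ∕ lucas (suc m)
cfrac-aTail₀ zero = just-⇓ (≐-resp
  (solve 2 (λ t u → t ⊜ t :* Κ 1P :+ :- (u :* Κ [])) ≋-refl polT polU)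
  (solve 1 (λ u → u ⊜ u :* Κ 1P) ≋-refl polU)
  (≐-self TdivU))
cfrac-aTail₀ (suc m) = ⇓-map
  (≐-rescale (neg 1P) (inj₂ ≡.refl)
    (solve 4 (λ t u a b → t :* (:- a) :+ b :* u ⊜ (:- Κ 1P) :* (t :* a :+ :- (u :* b))) ≋-refl polT polU a b)
    (solve 2 (λ u a → u :* (:- a) ⊜ (:- Κ 1P) :* (u :* a)) ≋-refl polU a))
  (cfrac-∷-⇓ {ds = applyUpTo aTail m} (≐-self TdivU) (cfrac-aTail₁ m) (sign-ev-neg a (sign-ev-lucas (suc m))))
  where
  a = lucas (suc (suc m))
  b = lucas (suc m)
cfrac-aTail₁ zero = just-⇓ (≐-resp
  (solve 2 (λ t u → :- t ⊜ :- (t :* Κ 1P :+ :- (u :* Κ []))) ≋-refl polT polU)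
  ≋-refl
  (≐-self (-C TC)))
cfrac-aTail₁ (suc m) = ⇓-map
  (≐-resp
    (solve 4 (λ t u a b → (:- t) :* a :+ u :* b :* Κ 1P ⊜ :- (t :* a :+ :- (u :* b))) ≋-refl polT polU a b)
    (⊗-identityˡ a))
  (cfrac-∷-⇓ {ds = applyUpTo (λ i → aTail (suc i)) m} (≐-self (-C TC)) (cfrac-aTail₀ m) (sign-ev-lucas (suc m)))
  where
  a = lucas (suc (suc m))
  b = lucas (suc m)

cfrac-aSeq : ∀ M → cfrac (aSeq 0) (applyUpTo (λ i → aSeq (suc i)) M) ⇓ polU ⊗ lucas M ∕ lucas (suc M)
cfrac-aSeq zero = just-⇓ 0C-≐
cfrac-aSeq (suc m) = ⇓-map
  (≐-resp
    (solve 3 (λ u a b → Κ [] :* a :+ u :* b :* Κ 1P ⊜ u :* b) ≋-refl polU (lucas (suc (suc m))) (lucas (suc m)))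
    (⊗-identityˡ (lucas (suc (suc m)))))
  (cfrac-∷-⇓ {ds = applyUpTo (λ i → aTail (suc i)) m} (≐-self 0C) (cfrac-aTail₀ m) (sign-ev-lucas (suc m)))

cfrac-bTail₀ : ∀ m → cfrac (bTail 0) (applyUpTo (λ i → bTail (suc i)) m)
                       ⇓ neg (lucas (suc (suc m))) ∕ polU ⊗ lucas (suc m)
cfrac-bTail₁ : ∀ m → cfrac (bTail 1) (applyUpTo bTail m) ⇓ lucas (suc (suc m)) ∕ lucas (suc m)
cfrac-bTail₀ zero = just-⇓ (≐-resp
  (solve 2 (λ t u → :- t ⊜ :- (t :* Κ 1P :+ :- (u :* Κ []))) ≋-refl polT polU)
  (solve 1 (λ u → u ⊜ u :* Κ 1P) ≋-refl polU)
  (≐-self (-C TdivU)))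
cfrac-bTail₀ (suc m) = ⇓-map
  (≐-resp
    (solve 4 (λ t u a b → (:- t) :* a :+ b :* u ⊜ :- (t :* a :+ :- (u :* b))) ≋-refl polT polU a b)
    ≋-refl)
  (cfrac-∷-⇓ {ds = applyUpTo bTail m} (≐-self (-C TdivU)) (cfrac-bTail₁ m) (sign-ev-lucas (suc m)))
  where
  a = lucas (suc (suc m))
  b = lucas (suc m)
cfrac-bTail₁ zero = just-⇓ TC-≐
cfrac-bTail₁ (suc m) = ⇓-map
  (≐-rescale (neg 1P) (inj₂ ≡.refl)
    (solve 4 (λ t u a b → t :* (:- a) :+ u :* b :* Κ 1P ⊜ (:- Κ 1P) :* (t :* a :+ :- (u :* b))) ≋-refl polT polU a b)
    (solve 1 (λ a → Κ 1P :* (:- a) ⊜ (:- Κ 1P) :* a) ≋-refl a))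
  (cfrac-∷-⇓ {ds = applyUpTo (λ i → bTail (suc i)) m} (≐-self TC) (cfrac-bTail₀ m) (sign-ev-neg a (sign-ev-lucas (suc m))))
  where
  a = lucas (suc (suc m))
  b = lucas (suc m)

ev-newton-denominator : ∀ A B → ev (A ⊕ A ⊕ neg (polT ⊗ B)) ≡ ev A ℚ.+ ev A ℚ.+ ℚ.- ev B
ev-newton-denominator A B = begin
  ev (A ⊕ A ⊕ neg (polT ⊗ B))             ≡⟨ ev-⊕ (A ⊕ A) (neg (polT ⊗ B)) ⟩
  ev (A ⊕ A) ℚ.+ ev (neg (polT ⊗ B))      ≡⟨ ≡.cong₂ ℚ._+_ (ev-⊕ A A) (ev-neg (polT ⊗ B)) ⟩
  ev A ℚ.+ ev A ℚ.+ ℚ.- ev (polT ⊗ B)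
    ≡⟨ ≡.cong (λ b → ev A ℚ.+ ev A ℚ.+ ℚ.- b) (≡.trans (ev-⊗ polT B) (ℚ.*-identityˡ (ev B))) ⟩
  ev A ℚ.+ ev A ℚ.+ ℚ.- ev B              ∎
  where open ≡.≡-Reasoning

newtonF-Ulucas∕lucas : ∀ K {x} → x ≐ polU ⊗ lucas K ∕ lucas (suc K) →
  newtonF x ⇓ polU ⊗ lucas (suc (K + K)) ∕ lucas (suc (suc (K + K)))
newtonF-Ulucas∕lucas K x≐ = ⇓-map (≐-rescale (neg 1P) (inj₂ ≡.refl) numerator≋ denominator≋)
  (newtonF-⇓ x≐ (sign-ev-lucas K) (inj₂ denominator-ev))
  where
  open import Relation.Binary.Reasoning.Setoid ≋-setoid
  a = lucas (suc K)
  b = lucas K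
  denominator-ev : ev (polU ⊗ b ⊕ polU ⊗ b ⊕ neg (polT ⊗ a)) ≡ ℚ.- 1ℚ
  denominator-ev = ≡.trans (ev-newton-denominator (polU ⊗ b) a)
    (≡.cong₂ (λ x y → x ℚ.+ x ℚ.+ ℚ.- y) (≡.trans (ev-⊗ polU b) (ℚ.*-zeroˡ (ev b))) (ev-lucas K))
  numerator≋ : polU ⊗ b ⊗ (polU ⊗ b) ⊕ neg (polU ⊗ a ⊗ a) ≋ neg 1P ⊗ (polU ⊗ lucas (suc (K + K)))
  numerator≋ = begin
    polU ⊗ b ⊗ (polU ⊗ b) ⊕ neg (polU ⊗ a ⊗ a)
      ≈⟨ solve 3 (λ u a b → u :* b :* (u :* b) :+ :- (u :* a :* a)
                            ⊜ (:- Κ 1P) :* (u :* (a :* a :+ :- (u :* b :* b))))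
           ≋-refl polU a b ⟩
    neg 1P ⊗ (polU ⊗ (a ⊗ a ⊕ neg (polU ⊗ b ⊗ b)))
      ≈⟨ ⊗-congˡ (neg 1P) (⊗-congˡ polU (lucas-+ K K)) ⟨
    neg 1P ⊗ (polU ⊗ lucas (suc (K + K)))  ∎
  denominator≋ : a ⊗ (polU ⊗ b ⊕ polU ⊗ b ⊕ neg (polT ⊗ a)) ≋ neg 1P ⊗ lucas (suc (suc (K + K)))
  denominator≋ = begin
    a ⊗ (polU ⊗ b ⊕ polU ⊗ b ⊕ neg (polT ⊗ a))
      ≈⟨ solve 4 (λ t u a b → a :* (u :* b :+ u :* b :+ :- (t :* a))
                              ⊜ (:- Κ 1P) :* ((t :* a :+ :- (u :* b)) :* a :+ :- (u :* a :* b)))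
           ≋-refl polT polU a b ⟩
    neg 1P ⊗ (lucas (suc (suc K)) ⊗ a ⊕ neg (polU ⊗ a ⊗ b))  ≈⟨ ⊗-congˡ (neg 1P) (lucas-+ (suc K) K) ⟨
    neg 1P ⊗ lucas (suc (suc (K + K)))  ∎

newtonF-lucas∕lucas : ∀ K {x} → x ≐ lucas (suc (suc K)) ∕ lucas (suc K) →
  newtonF x ⇓ lucas (suc (suc (suc (K + K)))) ∕ lucas (suc (suc (K + K)))
newtonF-lucas∕lucas K x≐ = ⇓-map (≐-resp numerator≋ denominator≋)
  (newtonF-⇓ x≐ (sign-ev-lucas K) (inj₁ denominator-ev))
  where
  open import Relation.Binary.Reasoning.Setoid ≋-setoid
  a = lucas (suc (suc K))
  b = lucas (suc K)
  c = lucas K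
  denominator-ev : ev (a ⊕ a ⊕ neg (polT ⊗ b)) ≡ 1ℚ
  denominator-ev = ≡.trans (ev-newton-denominator a b)
    (≡.cong₂ (λ x y → x ℚ.+ x ℚ.+ ℚ.- y) (ev-lucas (suc K)) (ev-lucas K))
  numerator≋ : a ⊗ a ⊕ neg (polU ⊗ b ⊗ b) ≋ lucas (suc (suc (suc (K + K))))
  numerator≋ = begin
    a ⊗ a ⊕ neg (polU ⊗ b ⊗ b)          ≈⟨ lucas-+ (suc K) (suc K) ⟨
    lucas (suc (suc (K + suc K)))       ≡⟨ ≡.cong (λ k → lucas (suc (suc k))) (+-suc K K) ⟩
    lucas (suc (suc (suc (K + K))))     ∎
  denominator≋ : b ⊗ (a ⊕ a ⊕ neg (polT ⊗ b)) ≋ lucas (suc (suc (K + K)))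
  denominator≋ = begin
    b ⊗ (a ⊕ a ⊕ neg (polT ⊗ b))
      ≈⟨ solve 4 (λ t u b c → b :* ((t :* b :+ :- (u :* c)) :+ (t :* b :+ :- (u :* c)) :+ :- (t :* b))
                              ⊜ (t :* b :+ :- (u :* c)) :* b :+ :- (u :* b :* c))
           ≋-refl polT polU b c ⟩
    a ⊗ b ⊕ neg (polU ⊗ b ⊗ c)   ≈⟨ lucas-+ (suc K) K ⟨
    lucas (suc (suc (K + K)))    ∎

2^suc∸1 : ∀ n → 2 ^ suc n ∸ 1 ≡ suc ((2 ^ n ∸ 1) + (2 ^ n ∸ 1))
2^suc∸1 n = double∸1 (2 ^ n) {{m^n≢0 2 n}}
  where
  double∸1 : ∀ m → .{{NonZero m}} → 2 * m ∸ 1 ≡ suc ((m ∸ 1) + (m ∸ 1))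
  double∸1 (suc k) = ≡.trans (+-suc k (k + 0)) (≡.cong (λ j → suc (k + j)) (+-identityʳ k))

iterF-0C-⇓ : ∀ n → iterF n 0C ⇓ polU ⊗ lucas (2 ^ n ∸ 1) ∕ lucas (suc (2 ^ n ∸ 1))
iterF-0C-⇓ zero = just-⇓ 0C-≐
iterF-0C-⇓ (suc n) rewrite 2^suc∸1 n = >>=-⇓ (iterF-0C-⇓ n) (newtonF-Ulucas∕lucas (2 ^ n ∸ 1))

iterF-TC-⇓ : ∀ n → iterF n TC ⇓ lucas (suc (suc (2 ^ n ∸ 1))) ∕ lucas (suc (2 ^ n ∸ 1))
iterF-TC-⇓ zero = just-⇓ TC-≐
iterF-TC-⇓ (suc n) rewrite 2^suc∸1 n = >>=-⇓ (iterF-TC-⇓ n) (newtonF-lucas∕lucas (2 ^ n ∸ 1))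

lemma4p2 : (n : ℕ) →
    (∃[ x ] ∃[ y ] (iterF n 0C ≡ just x) × (cfrac (aSeq 0) (applyUpTo (λ i → aSeq (suc i)) (2 ^ n ∸ 1)) ≡ just y) × (x ≈C y))
    × (∃[ x ] ∃[ y ] (iterF n TC ≡ just x) × (cfrac (bSeq 0) (applyUpTo (λ i → bSeq (suc i)) (2 ^ n ∸ 1)) ≡ just y) × (x ≈C y))
lemma4p2 n =
  ⇓-agree (iterF-0C-⇓ n) (cfrac-aSeq (2 ^ n ∸ 1)) ,
  ⇓-agree (iterF-TC-⇓ n) (cfrac-bTail₁ (2 ^ n ∸ 1))
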